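{- Let $G$ be a chordal graph and $(T,\mathcal{S})$ a subtree model of $G$. Let $C,C',C''$ be three pairwise distinct maximal cliques of $G$. If the clique subtree $S_T(C')$ intersects the connecting path $p(S_T(C),S_T(C''))$, then $C'$ is a separator in $G$, i.e. there exist two vertices of $G$ not in $C'$ that lie in different connected components of $G-C'$.
   Context: A subtree model of $G$ is a pair $(T,\mathcal{S})$ with $T$ a tree and $\mathcal{S}=\{S_v\mid v\in V(G)\}$ a family of connected subtrees of $T$ such that $S_u\cap S_v\neq\emptyset$ iff $uv\in E(G)$. For a maximal clique $C$ of $G$, the clique subtree is $S_T(C)=\bigcap_{v\in C}S_v$, which is nonempty (Helly property); clique subtrees of distinct maximal cliques are disjoint. For two disjoint subtrees $S,S'$ of $T$, the connecting path $p(S,S')$ is the minimal subgraph $P$ of $T$ (a path) such that $S\cup S'\cup P$ is connected; it contains exactly one node of each of $S$ and $S'$. -}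

module Defs where

open import Data.Nat using (ℕ; zero; suc; _<_; _≤_; _∸_)
open import Data.Fin using (Fin)
open import Data.Fin.Subset using (Subset; _∈_; _∉_; _⊆_)
open import Data.List using (List; []; _∷_)
open import Data.List.Membership.Propositional using () renaming (_∈_ to _∈ₗ_)
open import Data.List.Relation.Unary.Unique.Propositional using (Unique)
open import Data.Product using (Σ; ∃; ∃-syntax; _×_; _,_)
open import Relation.Nullary using (¬_)
open import Relation.Binary.PropositionalEquality using (_≡_; _≢_)
open import Function.Bundles using (_⇔_)

data Walk {V : Set} (E : V → V → Set) : V → V → Set where
  [] : ∀ {x} → Walk E x x
  _∷_ : ∀ {x y z} → E x y → Walk E y z → Walk E x z

vertices : ∀ {V : Set} {E : V → V → Set} {x y : V} → Walk E x y → List V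
vertices {x = x} [] = x ∷ []
vertices {x = x} (_ ∷ w) = x ∷ vertices w

edgeCount : ∀ {V : Set} {E : V → V → Set} {x y : V} → Walk E x y → ℕ
edgeCount [] = zero
edgeCount (_ ∷ w) = suc (edgeCount w)

IsPath : ∀ {V : Set} {E : V → V → Set} {x y : V} → Walk E x y → Set
IsPath w = Unique (vertices w)

AllOn : ∀ {V : Set} {E : V → V → Set} {x y : V} → (V → Set) → Walk E x y → Set
AllOn P w = ∀ z → z ∈ₗ vertices w → P z

record Graph (n : ℕ) : Set₁ where
  field
    E     : Fin n → Fin n → Set
    sym   : ∀ {u v} → E u v → E v u
    irrefl : ∀ {u} → ¬ E u u

Acyclic : ∀ {V : Set} → (V → V → Set) → Set
Acyclic E = ∀ {x y} (p : Walk E x y) → IsPath p → 2 ≤ edgeCount p → ¬ E y x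

Connected : ∀ {V : Set} → (V → V → Set) → Set
Connected E = ∀ x y → Walk E x y

IsCycle : ∀ {V : Set} → (V → V → Set) → (k : ℕ) → (ℕ → V) → Set
IsCycle E k f =
  (∀ i j → i < k → j < k → f i ≡ f j → i ≡ j) ×
  (∀ i → suc i < k → E (f i) (f (suc i))) ×
  E (f (k ∸ 1)) (f 0)

HasChord : ∀ {V : Set} → (V → V → Set) → (k : ℕ) → (ℕ → V) → Set
HasChord E k f =
  ∃[ i ] ∃[ j ] (i < j × j < k × j ≢ suc i × ¬ (i ≡ 0 × suc j ≡ k) × E (f i) (f j))

Chordal : ∀ {n} → Graph n → Set
Chordal {n} G = ∀ k (f : ℕ → Fin n) → 4 ≤ k → IsCycle (Graph.E G) k f → HasChord (Graph.E G) k f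

record Tree (m : ℕ) : Set₁ where
  field
    E      : Fin m → Fin m → Set
    sym    : ∀ {a b} → E a b → E b a
    irrefl : ∀ {a} → ¬ E a a
    connected : Connected E
    acyclic   : Acyclic E

IsSubtree : ∀ {m} → Tree m → (Fin m → Set) → Set
IsSubtree T S =
  (∃[ a ] S a) ×
  (∀ a b → S a → S b → Σ (Walk (Tree.E T) a b) (AllOn S))

record SubtreeModel {n} (G : Graph n) : Set₁ where
  field
    m : ℕ
    T : Tree m
    S : Fin n → Fin m → Set
    subtree : ∀ v → IsSubtree T (S v)
    model   : ∀ u v → u ≢ v → ((∃[ t ] (S u t × S v t)) ⇔ Graph.E G u v)

IsClique : ∀ {n} → Graph n → Subset n → Set
IsClique G C = ∀ u v → u ∈ C → v ∈ C → u ≢ v → Graph.E G u v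

IsMaximalClique : ∀ {n} → Graph n → Subset n → Set
IsMaximalClique G C = IsClique G C × (∀ D → IsClique G D → C ⊆ D → D ⊆ C)

cliqueSubtree : ∀ {n} {G : Graph n} (M : SubtreeModel G) → Subset n → Fin (SubtreeModel.m M) → Set
cliqueSubtree M C t = ∀ v → v ∈ C → SubtreeModel.S M v t

OnConnectingPath : ∀ {m} → Tree m → (Fin m → Set) → (Fin m → Set) → Fin m → Set
OnConnectingPath T A B t =
  ∃[ a ] ∃[ b ] Σ (Walk (Tree.E T) a b) λ p →
    IsPath p × A a × B b ×
    (∀ x → x ∈ₗ vertices p → A x → x ≡ a) ×
    (∀ x → x ∈ₗ vertices p → B x → x ≡ b) ×
    t ∈ₗ vertices p

ConnectedAvoiding : ∀ {n} → Graph n → Subset n → Fin n → Fin n → Set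
ConnectedAvoiding G C x y = Σ (Walk (Graph.E G) x y) (AllOn (_∉ C))

IsSeparator : ∀ {n} → Graph n → Subset n → Set
IsSeparator G C = ∃[ x ] ∃[ y ] (x ∉ C × y ∉ C × ¬ ConnectedAvoiding G C x y)

{-# OPTIONS --safe #-}
-- Take x ∈ C″ ∖ C′ and y ∈ C ∖ C′, which exist by maximality. If S_w contains a node t of
-- S_T(C′), then w is adjacent to all of C′ and hence lies in C′. So a walk from x to y in
-- G - C′ lifts to a walk in T from a node of S_T(C″) to a node of S_T(C) that misses t.
-- In a tree, however, every walk between the ends of a path visits all of its nodes, and t
-- lies on the connecting path.
module Submission where

open import Defs
open import Data.Nat using (_≤_; _+_; s≤s; z≤n)
open import Data.Nat.Properties using (+-mono-≤)
open import Data.Fin using (Fin)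
open import Data.Fin.Properties using (_≟_; any?)
open import Data.Fin.Subset using (Subset; _∈_; _∉_; _∪_; ⁅_⁆)
open import Data.Fin.Subset.Properties
  using (x∈p∪q⁻; x∈p∪q⁺; p⊆p∪q; x∈⁅x⁆; x∈⁅y⁆⇒x≡y; ⊆-antisym)
  renaming (_∈?_ to _∈ₛ?_)
open import Data.List.Relation.Unary.Any using (here; there)
open import Data.List.Relation.Unary.All using ([]; _∷_; lookup)
open import Data.List.Relation.Unary.All.Properties using (¬Any⇒All¬; anti-mono)
open import Data.List.Relation.Unary.AllPairs using ([]; _∷_)
open import Data.List.Membership.Propositional using () renaming (_∈_ to _∈ₗ_; _∉_ to _∉ₗ_)
import Data.List.Membership.DecPropositional as DecMembership
open import Data.List.Relation.Binary.Subset.Propositional using () renaming (_⊆_ to _⊆ₗ_)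
open import Data.Product using (Σ; ∃-syntax; _×_; _,_; proj₁; proj₂)
open import Data.Sum using (_⊎_; inj₁; inj₂; [_,_]′)
import Data.Sum as Sum
open import Data.Empty using (⊥-elim)
open import Function using (_∘_)
open import Function.Bundles using (Equivalence)
open import Relation.Nullary using (¬_; yes; no; ¬?)
open import Relation.Nullary.Decidable using (_×-dec_)
open import Relation.Unary using (Decidable)
open import Relation.Binary.PropositionalEquality using (_≡_; _≢_; refl; sym; trans; subst)
open import Relation.Binary.Definitions using (DecidableEquality)

module _ {V : Set} {E : V → V → Set} where

  infixr 5 _++ʷ_
  _++ʷ_ : ∀ {x y z} → Walk E x y → Walk E y z → Walk E x z
  []      ++ʷ β = β
  (e ∷ α) ++ʷ β = e ∷ (α ++ʷ β)

  head∈vertices : ∀ {x y} (w : Walk E x y) → x ∈ₗ vertices w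
  head∈vertices []      = here refl
  head∈vertices (_ ∷ _) = here refl

  last∈vertices : ∀ {x y} (w : Walk E x y) → y ∈ₗ vertices w
  last∈vertices []      = here refl
  last∈vertices (_ ∷ w) = there (last∈vertices w)

  ∈-++ʷ⁻ : ∀ {x y z v} (α : Walk E x y) (β : Walk E y z) →
    v ∈ₗ vertices (α ++ʷ β) → v ∈ₗ vertices α ⊎ v ∈ₗ vertices β
  ∈-++ʷ⁻ []      β v∈         = inj₂ v∈
  ∈-++ʷ⁻ (e ∷ α) β (here v≡x) = inj₁ (here v≡x)
  ∈-++ʷ⁻ (e ∷ α) β (there v∈) = Sum.map₁ there (∈-++ʷ⁻ α β v∈)

  AllOn-++ʷ : ∀ {P : V → Set} {x y z} (α : Walk E x y) (β : Walk E y z) →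
    AllOn P α → AllOn P β → AllOn P (α ++ʷ β)
  AllOn-++ʷ α β Pα Pβ v v∈ = [ Pα v , Pβ v ]′ (∈-++ʷ⁻ α β v∈)

  edgeCount-++ʷ : ∀ {x y z} (α : Walk E x y) (β : Walk E y z) →
    edgeCount (α ++ʷ β) ≡ edgeCount α + edgeCount β
  edgeCount-++ʷ []      β = refl
  edgeCount-++ʷ (e ∷ α) β rewrite edgeCount-++ʷ α β = refl

  ≢⇒1≤edgeCount : ∀ {x y} → x ≢ y → (w : Walk E x y) → 1 ≤ edgeCount w
  ≢⇒1≤edgeCount x≢x []      = ⊥-elim (x≢x refl)
  ≢⇒1≤edgeCount _   (_ ∷ _) = s≤s z≤n

  ++ʷ-isPath : ∀ {x y z} (α : Walk E x y) (β : Walk E y z) → IsPath α → IsPath β →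
    (∀ {v} → v ∈ₗ vertices α → v ∈ₗ vertices β → v ≡ y) → IsPath (α ++ʷ β)
  ++ʷ-isPath []      β _ β-path _ = β-path
  ++ʷ-isPath {x} (e ∷ α) β (x∉α ∷ α-path) β-path meet =
    ¬Any⇒All¬ _ x∉α++β ∷ ++ʷ-isPath α β α-path β-path (meet ∘ there)
    where
    x∉α++β : x ∉ₗ vertices (α ++ʷ β)
    x∉α++β x∈ with ∈-++ʷ⁻ α β x∈
    ... | inj₁ x∈α = lookup x∉α x∈α refl
    ... | inj₂ x∈β = lookup x∉α (subst (_∈ₗ vertices α) (sym (meet (here refl) x∈β)) (last∈vertices α)) refl

  record Split {x y} (w : Walk E x y) (v : V) : Set where
    field
      prefix      : Walk E x v
      suffix      : Walk E v y
      prefix-path : IsPath prefix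
      suffix-path : IsPath suffix
      prefix⊆     : vertices prefix ⊆ₗ vertices w
      suffix⊆     : vertices suffix ⊆ₗ vertices w
      meet        : ∀ {u} → u ∈ₗ vertices prefix → u ∈ₗ vertices suffix → u ≡ v

  split : ∀ {x y v} (w : Walk E x y) → IsPath w → v ∈ₗ vertices w → Split w v
  split [] w-path (here refl) = record
    { prefix = [] ; suffix = [] ; prefix-path = w-path ; suffix-path = w-path
    ; prefix⊆ = λ v∈ → v∈ ; suffix⊆ = λ v∈ → v∈ ; meet = λ { (here u≡v) _ → u≡v } }
  split (e ∷ w) w-path (here refl) = record
    { prefix = [] ; suffix = e ∷ w ; prefix-path = [] ∷ [] ; suffix-path = w-path
    ; prefix⊆ = λ { (here u≡v) → here u≡v } ; suffix⊆ = λ v∈ → v∈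
    ; meet = λ { (here u≡v) _ → u≡v } }
  split (e ∷ w) (x∉w ∷ w-path) (there v∈) = record
    { prefix      = e ∷ prefix
    ; suffix      = suffix
    ; prefix-path = anti-mono prefix⊆ x∉w ∷ prefix-path
    ; suffix-path = suffix-path
    ; prefix⊆     = λ { (here u≡x) → here u≡x ; (there u∈) → there (prefix⊆ u∈) }
    ; suffix⊆     = there ∘ suffix⊆
    ; meet        = λ { (here refl) u∈ → ⊥-elim (lookup x∉w (suffix⊆ u∈) refl)
                      ; (there u∈) u∈′ → meet u∈ u∈′ } }
    where open Split (split w w-path v∈)

  shortcut : DecidableEquality V → ∀ {x y} (w : Walk E x y) →
    Σ (Walk E x y) λ p → IsPath p × vertices p ⊆ₗ vertices w
  shortcut _ [] = [] , [] ∷ [] , λ v∈ → v∈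
  shortcut _≟V_ {x} (e ∷ w) with shortcut _≟V_ w
  ... | p , p-path , p⊆w with DecMembership._∈?_ _≟V_ x (vertices p)
  ...   | yes x∈p = suffix , suffix-path , there ∘ p⊆w ∘ suffix⊆
    where open Split (split p p-path x∈p)
  ...   | no x∉p = e ∷ p , ¬Any⇒All¬ _ x∉p ∷ p-path ,
                   λ { (here v≡x) → here v≡x ; (there v∈) → there (p⊆w v∈) }

  record FirstHit (Q : V → Set) {x y} (w : Walk E x y) : Set where
    field
      z     : V
      run   : Walk E x z
      Qz    : Q z
      run⊆  : vertices run ⊆ₗ vertices w
      first : ∀ {u} → u ∈ₗ vertices run → Q u → u ≡ z

  firstHit : ∀ {Q : V → Set} → Decidable Q → ∀ {x y} (w : Walk E x y) → Q y → FirstHit Q w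
  firstHit Q? {x} w Qy with Q? x
  ... | yes Qx = record
    { z = x ; run = [] ; Qz = Qx ; run⊆ = λ { (here refl) → head∈vertices w }
    ; first = λ { (here u≡x) _ → u≡x } }
  firstHit Q? []      Qy | no ¬Qx = ⊥-elim (¬Qx Qy)
  firstHit Q? (e ∷ w) Qy | no ¬Qx = record
    { z = z ; run = e ∷ run ; Qz = Qz
    ; run⊆  = λ { (here u≡x) → here u≡x ; (there u∈) → there (run⊆ u∈) }
    ; first = λ { (here refl) Qu → ⊥-elim (¬Qx Qu) ; (there u∈) Qu → first u∈ Qu } }
    where open FirstHit (firstHit Q? w Qy)

module _ {m} (T : Tree m) where
  open Tree T using (E; acyclic)

  detour-closes-cycle : ∀ {t u a} → E t u → (π : Walk E a t) → IsPath π → u ∉ₗ vertices π →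
    (ω : Walk E u a) → ¬ AllOn (_≢ t) ω
  detour-closes-cycle {t} {u} e π π-path u∉π ω ω-avoids =
    acyclic (α ++ʷ γ) (++ʷ-isPath α γ α-path suffix-path α∩γ) 2≤edges e
    where
    open FirstHit (firstHit (λ v → DecMembership._∈?_ _≟_ v (vertices π)) ω (head∈vertices π))
    α-short = shortcut _≟_ run
    α = proj₁ α-short
    α-path = proj₁ (proj₂ α-short)
    α⊆run = proj₂ (proj₂ α-short)
    open Split (split π π-path Qz)
    γ = suffix
    α∩γ : ∀ {v} → v ∈ₗ vertices α → v ∈ₗ vertices γ → v ≡ z
    α∩γ v∈α v∈γ = first (α⊆run v∈α) (suffix⊆ v∈γ)
    u≢z : u ≢ z
    u≢z u≡z = u∉π (subst (_∈ₗ vertices π) (sym u≡z) Qz)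
    z≢t : z ≢ t
    z≢t = ω-avoids z (run⊆ (last∈vertices run))
    2≤edges : 2 ≤ edgeCount (α ++ʷ γ)
    2≤edges = subst (2 ≤_) (sym (edgeCount-++ʷ α γ))
                (+-mono-≤ (≢⇒1≤edgeCount u≢z α) (≢⇒1≤edgeCount z≢t γ))

  path-vertex-on-return-walk : ∀ {a b t} (p : Walk E a b) → IsPath p → t ∈ₗ vertices p →
    (w : Walk E b a) → ¬ AllOn (_≢ t) w
  path-vertex-on-return-walk p p-path t∈p =
    closing prefix suffix prefix-path suffix-path meet
    where
    open Split (split p p-path t∈p)
    closing : ∀ {a b t} (p₁ : Walk E a t) (p₂ : Walk E t b) → IsPath p₁ → IsPath p₂ →
      (∀ {v} → v ∈ₗ vertices p₁ → v ∈ₗ vertices p₂ → v ≡ t) →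
      (w : Walk E b a) → ¬ AllOn (_≢ t) w
    closing p₁ [] _ _ _ w w-avoids = w-avoids _ (head∈vertices w) refl
    closing {t = t} p₁ (_∷_ {y = u} e p₂) p₁-path (t∉p₂ ∷ _) meet w w-avoids =
      detour-closes-cycle e p₁ p₁-path u∉p₁ (p₂ ++ʷ w) (AllOn-++ʷ p₂ w p₂-avoids w-avoids)
      where
      p₂-avoids : AllOn (_≢ t) p₂
      p₂-avoids v v∈p₂ v≡t = lookup t∉p₂ v∈p₂ (sym v≡t)
      u∉p₁ : u ∉ₗ vertices p₁
      u∉p₁ u∈p₁ = p₂-avoids u (head∈vertices p₂) (meet u∈p₁ (there (head∈vertices p₂)))

module _ {n} (G : Graph n) where
  open Graph G using (E; irrefl)

  adjacent⇒≢ : ∀ {u v} → E u v → u ≢ v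
  adjacent⇒≢ e refl = irrefl e

  ∪⁅⁆-isClique : ∀ {C w} → IsClique G C → (∀ v → v ∈ C → v ≢ w → E v w) → IsClique G (C ∪ ⁅ w ⁆)
  ∪⁅⁆-isClique {C} {w} C-clique w-adj u v u∈ v∈ u≢v
    with x∈p∪q⁻ C ⁅ w ⁆ u∈ | x∈p∪q⁻ C ⁅ w ⁆ v∈
  ... | inj₁ u∈C | inj₁ v∈C = C-clique u v u∈C v∈C u≢v
  ... | inj₁ u∈C | inj₂ v∈w rewrite x∈⁅y⁆⇒x≡y w v∈w = w-adj u u∈C u≢v
  ... | inj₂ u∈w | inj₁ v∈C rewrite x∈⁅y⁆⇒x≡y w u∈w = Graph.sym G (w-adj v v∈C (u≢v ∘ sym))
  ... | inj₂ u∈w | inj₂ v∈w = ⊥-elim (u≢v (trans (x∈⁅y⁆⇒x≡y w u∈w) (sym (x∈⁅y⁆⇒x≡y w v∈w))))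

  maximalClique⊈clique : ∀ {C D} → IsMaximalClique G C → IsClique G D → C ≢ D →
    ∃[ x ] (x ∈ C × x ∉ D)
  maximalClique⊈clique {C} {D} (_ , C-maximal) D-clique C≢D
    with any? (λ x → x ∈ₛ? C ×-dec ¬? (x ∈ₛ? D))
  ... | yes witness = witness
  ... | no ¬witness = ⊥-elim (C≢D (⊆-antisym C⊆D (C-maximal D D-clique C⊆D)))
    where
    C⊆D : ∀ {x} → x ∈ C → x ∈ D
    C⊆D {x} x∈C with x ∈ₛ? D
    ... | yes x∈D = x∈D
    ... | no x∉D = ⊥-elim (¬witness (x , x∈C , x∉D))

module _ {n} {G : Graph n} (M : SubtreeModel G) where
  open SubtreeModel M

  meets-cliqueSubtree⇒∈ : ∀ {C w t} → IsMaximalClique G C → cliqueSubtree M C t → S w t → w ∈ C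
  meets-cliqueSubtree⇒∈ {C} {w} {t} (C-clique , C-maximal) t∈SC t∈Sw =
    C-maximal (C ∪ ⁅ w ⁆) (∪⁅⁆-isClique G C-clique w-adj) (p⊆p∪q ⁅ w ⁆) (x∈p∪q⁺ (inj₂ (x∈⁅x⁆ w)))
    where
    w-adj : ∀ v → v ∈ C → v ≢ w → Graph.E G v w
    w-adj v v∈C v≢w = Equivalence.to (model v w v≢w) (t , t∈SC v v∈C , t∈Sw)

  liftWalk : ∀ {x y a b} (R : Fin m → Set) (g : Walk (Graph.E G) x y) →
    AllOn (λ v → ∀ {s} → S v s → R s) g → S x a → S y b → Σ (Walk (Tree.E T) a b) (AllOn R)
  liftWalk {x} R [] S⊆R a∈Sx b∈Sx =
    let w , w-inside = proj₂ (subtree x) _ _ a∈Sx b∈Sx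
    in w , λ s s∈w → S⊆R x (here refl) (w-inside s s∈w)
  liftWalk {x} R (_∷_ {y = x′} e g) S⊆R a∈Sx b∈Sy =
    let s , s∈Sx , s∈Sx′ = Equivalence.from (model x x′ (adjacent⇒≢ G e)) e
        w₁ , w₁-inside = proj₂ (subtree x) _ _ a∈Sx s∈Sx
        w₂ , w₂-in-R = liftWalk R g (λ v v∈g → S⊆R v (there v∈g)) s∈Sx′ b∈Sy
    in w₁ ++ʷ w₂ , AllOn-++ʷ w₁ w₂ (λ s s∈w₁ → S⊆R x (here refl) (w₁-inside s s∈w₁)) w₂-in-R

  liftWalk-avoiding : ∀ {C t x y a b} → IsMaximalClique G C → cliqueSubtree M C t →
    ConnectedAvoiding G C x y → S x a → S y b → Σ (Walk (Tree.E T) a b) (AllOn (_≢ t))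
  liftWalk-avoiding {t = t} C-maximal t∈SC (g , g-avoids) =
    liftWalk (_≢ t) g (λ v v∈g {s} s∈Sv s≡t →
      g-avoids v v∈g (meets-cliqueSubtree⇒∈ C-maximal t∈SC (subst (S v) s≡t s∈Sv)))

lemma4 : ∀ {n} (G : Graph n) → Chordal G → (M : SubtreeModel G) →
    (C C′ C″ : Subset n) →
    IsMaximalClique G C → IsMaximalClique G C′ → IsMaximalClique G C″ →
    C ≢ C′ → C′ ≢ C″ → C ≢ C″ →
    (∃[ t ] (cliqueSubtree M C′ t × OnConnectingPath (SubtreeModel.T M) (cliqueSubtree M C) (cliqueSubtree M C″) t)) →
    IsSeparator G C′
lemma4 G _ M C C′ C″ C-max C′-max C″-max C≢C′ C′≢C″ _
  (t , t∈SC′ , a , b , p , p-path , a∈SC , b∈SC″ , _ , _ , t∈p)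
  with maximalClique⊈clique G C″-max (proj₁ C′-max) (C′≢C″ ∘ sym)
     | maximalClique⊈clique G C-max (proj₁ C′-max) C≢C′
... | x , x∈C″ , x∉C′ | y , y∈C , y∉C′ = x , y , x∉C′ , y∉C′ , λ x~y →
  let w , w-avoids = liftWalk-avoiding M C′-max t∈SC′ x~y (b∈SC″ x x∈C″) (a∈SC y y∈C)
  in path-vertex-on-return-walk (SubtreeModel.T M) p p-path t∈p w w-avoids
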